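{- Let $A,K\in\mathbb{N}$ and $\xi=1-\frac{1}{K+1}$. There exists $N_{A,K}\in\mathbb{N}$, depending only on $A$ and $K$, such that for every $n\ge N_{A,K}$ and every positive integer $k\le An^K$ the following holds: if $X\in\mathbb{N}^k$ is the random vector giving the numbers of robots at each of $k$ destinations when $n$ robots each independently choose one of the $k$ destinations uniformly at random, and $\|X\|_\infty=\max_i X_i$, then \[\mathbb{P}\Big(\|X\|_\infty>\tfrac{n}{k}\big(1+k^{\xi}\big)\Big)\le \tfrac12 .\] -}

module Defs where

open import Data.Nat using (ℕ; zero; suc; _+_; _*_; _∸_; _^_; _<_; _⊔_; _<?_)
open import Data.Fin using (Fin; _≟_)
open import Data.Vec using (Vec; []; _∷_; toList)
open import Data.List using (List; [_]; length; filter; map; foldr; concatMap; allFin)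
open import Data.Product using (_×_)
open import Relation.Nullary.Decidable using (_×-dec_)
open import Relation.Nullary using (Dec)

-- An outcome of the experiment: robot j (j : Fin n) chooses destination v[j] : Fin k.
-- allOutcomes k n enumerates all k^n equally likely outcomes.
allOutcomes : (k n : ℕ) → List (Vec (Fin k) n)
allOutcomes k zero    = [ [] ]
allOutcomes k (suc n) = concatMap (λ i → map (i ∷_) (allOutcomes k n)) (allFin k)

load : ∀ {k n} → Vec (Fin k) n → Fin k → ℕ
load v i = length (filter (_≟ i) (toList v))

maxLoad : ∀ {k n} → Vec (Fin k) n → ℕ
maxLoad {k} v = foldr _⊔_ 0 (map (load v) (allFin k))

-- The event  M > (n/k)(1 + k^(K/(K+1)))  for M = ‖X‖∞, k ≥ 1, stated exactly in ℕ:
--   k M > n + n k^(K/(K+1))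
--   ⇔ k M > n  and  (k M − n)^(K+1) > n^(K+1) k^K.
Exceeds : (K n k M : ℕ) → Set
Exceeds K n k M = (n < k * M) × (n ^ suc K * k ^ K < (k * M ∸ n) ^ suc K)

exceeds? : (K n k M : ℕ) → Dec (Exceeds K n k M)
exceeds? K n k M = (n <? k * M) ×-dec (n ^ suc K * k ^ K <? (k * M ∸ n) ^ suc K)

badCount : (K n k : ℕ) → ℕ
badCount K n k = length (filter (λ v → exceeds? K n k (maxLoad v)) (allOutcomes k n))

-- Markov's inequality for the r-th factorial moment, r = (K+1)s.  Summed over
-- the k bins and the k^n outcomes, the falling factorials (X_i)_r add up to
-- k (n)_r k^(n-r): each ordered r-tuple of robots lands in a given bin in a
-- k^(-r) fraction of the outcomes.  On the bad event, once n is large, the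
-- excess k M - n of the maximal load M is at least 2kr, so the hypothesis gives
-- (kM - kr)^(K+1) / n^(K+1) >= 1 + k^K / 2^(K+1); Bernoulli's inequality with
-- s = 2^(K+2)(A+1) raises this to (k(M - r))^r / n^r >= 2k, whence
-- (M)_r k^r >= 2k (n)_r.  So the bad outcomes are at most half of all k^n.
module Submission where

open import Defs
open import Data.Nat using (ℕ; zero; suc; _+_; _*_; _∸_; _^_; _≤_; _<_; _>_; _⊔_; z≤n; s≤s; NonZero; >-nonZero; >-nonZero⁻¹)
open import Data.Nat.Properties hiding (_≟_)
open import Data.Nat.Combinatorics.Base using (_P′_)
open import Data.Nat.Combinatorics.Specification using (P′-rec)
open import Data.Nat.Tactic.RingSolver using (solve-∀)
open import Algebra.Properties.CommutativeSemigroup *-commutativeSemigroup using (x∙yz≈y∙xz)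
open import Data.Fin using (Fin; _≟_)
import Data.Fin as Fin
open import Data.Vec using (Vec; _∷_)
open import Data.List using (List; []; _∷_; length; filter; map; foldr; concatMap; allFin; tabulate; _++_)
open import Data.List.Properties using (length-tabulate; map-tabulate)
open import Data.Bool using (true; false; if_then_else_)
open import Data.Product using (_,_; ∃-syntax)
open import Data.Sum using (inj₁; inj₂)
open import Function using (_∘_)
open import Relation.Nullary using (yes; no; does)
open import Relation.Unary using (Decidable)
open import Relation.Binary.PropositionalEquality

private
  variable
    A B : Set

-- The library's falling factorial n P′ r = n (n - 1) ⋯ (n - r + 1); it binds
-- more loosely than _*_.

P′-vanish : ∀ {n r} → n < r → n P′ r ≡ 0
P′-vanish {n} {suc r} n<1+r with m<1+n⇒m<n∨m≡n n<1+r
... | inj₁ n<r  = trans (cong ((n ∸ r) *_) (P′-vanish n<r)) (*-zeroʳ (n ∸ r))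
... | inj₂ refl = cong (_* (n P′ n)) (n∸n≡0 n)

P′-pascal : ∀ n r → suc n P′ suc r ≡ n P′ suc r + suc r * (n P′ r)
P′-pascal n r with r ≤? n
... | yes r≤n = trans (P′-rec (s≤s r≤n)) (+-comm (suc r * (n P′ r)) (n P′ suc r))
... | no  r≰n = trans (P′-vanish (s≤s n<r)) (sym (trans
                   (cong₂ (λ a b → a + suc r * b) (P′-vanish (m<n⇒m<1+n n<r)) (P′-vanish n<r))
                   (*-zeroʳ (suc r))))
  where
  n<r : n < r
  n<r = ≰⇒> r≰n

P′≤^ : ∀ n r → n P′ r ≤ n ^ r
P′≤^ n zero    = ≤-refl
P′≤^ n (suc r) = *-mono-≤ (m∸n≤m n r) (P′≤^ n r)

∸^≤P′ : ∀ n r → (n ∸ r) ^ r ≤ n P′ r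
∸^≤P′ n zero    = ≤-refl
∸^≤P′ n (suc r) = *-mono-≤ n∸1+r≤n∸r (≤-trans (^-monoˡ-≤ r n∸1+r≤n∸r) (∸^≤P′ n r))
  where
  n∸1+r≤n∸r : n ∸ suc r ≤ n ∸ r
  n∸1+r≤n∸r = ∸-monoʳ-≤ n (n≤1+n r)

P′>0 : ∀ {n r} → r ≤ n → n P′ r > 0
P′>0 {r = zero}  _   = s≤s z≤n
P′>0 {r = suc r} r<n = *-mono-< (m<n⇒0<n∸m r<n) (P′>0 (<⇒≤ r<n))

^-distribʳ-* : ∀ m n o → (m * n) ^ o ≡ m ^ o * n ^ o
^-distribʳ-* m n zero    = refl
^-distribʳ-* m n (suc o) = trans (cong (m * n *_) (^-distribʳ-* m n o)) (*-*-interchange m n (m ^ o) (n ^ o))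
  where
  *-*-interchange : ∀ a b c d → a * b * (c * d) ≡ a * c * (b * d)
  *-*-interchange = solve-∀

m≤m^[1+n] : ∀ m n → m ≤ m ^ suc n
m≤m^[1+n] zero      n = z≤n
m≤m^[1+n] m@(suc _) n = m≤m*n m (m ^ n) {{m^n≢0 m n}}

^-superadditive : ∀ m n o → m ^ suc o + n ^ suc o ≤ (m + n) ^ suc o
^-superadditive m n o = begin
    m * m ^ o + n * n ^ o
  ≤⟨ +-mono-≤ (*-monoʳ-≤ m (^-monoˡ-≤ o (m≤m+n m n))) (*-monoʳ-≤ n (^-monoˡ-≤ o (m≤n+m n m))) ⟩
    m * (m + n) ^ o + n * (m + n) ^ o
  ≡⟨ *-distribʳ-+ ((m + n) ^ o) m n ⟨
    (m + n) * (m + n) ^ o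
  ∎
  where open ≤-Reasoning

-- Bernoulli's inequality (1 + d/c)^s ≥ 1 + s d/c with denominators cleared.
bernoulli : ∀ c d s → c ^ s * (c + s * d) ≤ c * (c + d) ^ s
bernoulli c d zero    = ≤-reflexive (base c d)
  where
  base : ∀ c d → 1 * (c + 0 * d) ≡ c * 1
  base = solve-∀
bernoulli c d (suc s) = begin
    c * c ^ s * (c + suc s * d)
  ≤⟨ m≤m+n _ (c ^ s * s * d * d) ⟩
    c * c ^ s * (c + suc s * d) + c ^ s * s * d * d
  ≡⟨ expand c d s (c ^ s) ⟩
    (c + d) * (c ^ s * (c + s * d))
  ≤⟨ *-monoʳ-≤ (c + d) (bernoulli c d s) ⟩
    (c + d) * (c * (c + d) ^ s)
  ≡⟨ x∙yz≈y∙xz (c + d) c ((c + d) ^ s) ⟩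
    c * ((c + d) * (c + d) ^ s)
  ∎
  where
  open ≤-Reasoning
  expand : ∀ c d s p → c * p * (c + suc s * d) + p * s * d * d ≡ (c + d) * (p * (c + s * d))
  expand = solve-∀

bernoulli-ratio : ∀ {c d t x y} s .{{_ : NonZero c}} →
                  (c + d) * y ≤ c * x → c * t ≤ c + s * d → t * y ^ s ≤ x ^ s
bernoulli-ratio {c} {d} {t} {x} {y} s ratio c*t≤c+sd = *-cancelˡ-≤ (c * c ^ s) {{m*n≢0 c (c ^ s)}} (begin
    c * c ^ s * (t * y ^ s)
  ≡⟨ regroup c (c ^ s) t (y ^ s) ⟩
    c ^ s * (c * t) * y ^ s
  ≤⟨ *-monoˡ-≤ (y ^ s) (*-monoʳ-≤ (c ^ s) c*t≤c+sd) ⟩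
    c ^ s * (c + s * d) * y ^ s
  ≤⟨ *-monoˡ-≤ (y ^ s) (bernoulli c d s) ⟩
    c * (c + d) ^ s * y ^ s
  ≡⟨ *-assoc c ((c + d) ^ s) (y ^ s) ⟩
    c * ((c + d) ^ s * y ^ s)
  ≡⟨ cong (c *_) (^-distribʳ-* (c + d) y s) ⟨
    c * ((c + d) * y) ^ s
  ≤⟨ *-monoʳ-≤ c (^-monoˡ-≤ s ratio) ⟩
    c * (c * x) ^ s
  ≡⟨ cong (c *_) (^-distribʳ-* c x s) ⟩
    c * (c ^ s * x ^ s)
  ≡⟨ *-assoc c (c ^ s) (x ^ s) ⟨
    c * c ^ s * x ^ s
  ∎)
  where
  open ≤-Reasoning
  instance
    c^s≢0 : NonZero (c ^ s)
    c^s≢0 = m^n≢0 c s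
  regroup : ∀ c p t q → c * p * (t * q) ≡ p * (c * t) * q
  regroup = solve-∀

excess⇒ratio : ∀ j {n m a d} → n ≤ m → 2 * a ≤ m ∸ n → n ^ suc j * d ≤ (m ∸ n) ^ suc j →
               (2 ^ suc j + d) * n ^ suc j ≤ 2 ^ suc j * (m ∸ a) ^ suc j
excess⇒ratio j {n} {m} {a} {d} n≤m 2a≤D y*d≤D^ = begin
    (c + d) * n ^ suc j
  ≡⟨ *-distribʳ-+ (n ^ suc j) c d ⟩
    c * n ^ suc j + d * n ^ suc j
  ≤⟨ +-monoʳ-≤ (c * n ^ suc j) (≤-trans (≤-reflexive (*-comm d (n ^ suc j))) y*d≤D^) ⟩
    c * n ^ suc j + D ^ suc j
  ≤⟨ +-monoʳ-≤ (c * n ^ suc j) (^-monoˡ-≤ (suc j) D≤2E) ⟩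
    c * n ^ suc j + (2 * E) ^ suc j
  ≡⟨ cong (c * n ^ suc j +_) (^-distribʳ-* 2 E (suc j)) ⟩
    c * n ^ suc j + c * E ^ suc j
  ≡⟨ *-distribˡ-+ c (n ^ suc j) (E ^ suc j) ⟨
    c * (n ^ suc j + E ^ suc j)
  ≤⟨ *-monoʳ-≤ c (^-superadditive n E j) ⟩
    c * (n + E) ^ suc j
  ≡⟨ cong (λ z → c * z ^ suc j) n+E≡m∸a ⟩
    c * (m ∸ a) ^ suc j
  ∎
  where
  open ≤-Reasoning
  c D E : ℕ
  c = 2 ^ suc j
  D = m ∸ n
  E = D ∸ a
  a+a≤D : a + a ≤ D
  a+a≤D = ≤-trans (≤-reflexive (cong (a +_) (sym (+-identityʳ a)))) 2a≤D
  a≤D : a ≤ D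
  a≤D = ≤-trans (m≤m+n a a) a+a≤D
  D≤2E : D ≤ 2 * E
  D≤2E = begin
      D
    ≡⟨ m∸n+n≡m a≤D ⟨
      E + a
    ≤⟨ +-monoʳ-≤ E (≤-trans (≤-reflexive (sym (m+n∸n≡m a a))) (∸-monoˡ-≤ a a+a≤D)) ⟩
      E + E
    ≡⟨ cong (E +_) (+-identityʳ E) ⟨
      2 * E
    ∎
  n+E≡m∸a : n + E ≡ m ∸ a
  n+E≡m∸a = trans (sym (+-∸-assoc n a≤D)) (cong (_∸ a) (m+[n∸m]≡n n≤m))

∑ : List A → (A → ℕ) → ℕ
∑ []       f = 0
∑ (x ∷ xs) f = f x + ∑ xs f

∑-cong : (xs : List A) {f g : A → ℕ} → (∀ x → f x ≡ g x) → ∑ xs f ≡ ∑ xs g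
∑-cong []       f≡g = refl
∑-cong (x ∷ xs) f≡g = cong₂ _+_ (f≡g x) (∑-cong xs f≡g)

∑-zero : (xs : List A) → ∑ xs (λ _ → 0) ≡ 0
∑-zero []       = refl
∑-zero (x ∷ xs) = ∑-zero xs

∑-const : (xs : List A) (c : ℕ) → ∑ xs (λ _ → c) ≡ length xs * c
∑-const []       c = refl
∑-const (x ∷ xs) c = cong (c +_) (∑-const xs c)

∑-+ : (xs : List A) (f g : A → ℕ) → ∑ xs (λ x → f x + g x) ≡ ∑ xs f + ∑ xs g
∑-+ []       f g = refl
∑-+ (x ∷ xs) f g = trans (cong (f x + g x +_) (∑-+ xs f g)) (+-interchange (f x) (g x) (∑ xs f) (∑ xs g))
  where
  +-interchange : ∀ a b c d → a + b + (c + d) ≡ a + c + (b + d)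
  +-interchange = solve-∀

∑-*ʳ : (xs : List A) (f : A → ℕ) (c : ℕ) → ∑ xs (λ x → f x * c) ≡ ∑ xs f * c
∑-*ʳ []       f c = refl
∑-*ʳ (x ∷ xs) f c = trans (cong (f x * c +_) (∑-*ʳ xs f c)) (sym (*-distribʳ-+ c (f x) (∑ xs f)))

∑-*ˡ : (xs : List A) (c : ℕ) (f : A → ℕ) → ∑ xs (λ x → c * f x) ≡ c * ∑ xs f
∑-*ˡ []       c f = sym (*-zeroʳ c)
∑-*ˡ (x ∷ xs) c f = trans (cong (c * f x +_) (∑-*ˡ xs c f)) (sym (*-distribˡ-+ c (f x) (∑ xs f)))

∑-++ : (xs ys : List A) (f : A → ℕ) → ∑ (xs ++ ys) f ≡ ∑ xs f + ∑ ys f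
∑-++ []       ys f = refl
∑-++ (x ∷ xs) ys f = trans (cong (f x +_) (∑-++ xs ys f)) (sym (+-assoc (f x) (∑ xs f) (∑ ys f)))

∑-map : (xs : List A) (h : A → B) (f : B → ℕ) → ∑ (map h xs) f ≡ ∑ xs (f ∘ h)
∑-map []       h f = refl
∑-map (x ∷ xs) h f = cong (f (h x) +_) (∑-map xs h f)

∑-concatMap : (xs : List A) (h : A → List B) (f : B → ℕ) →
              ∑ (concatMap h xs) f ≡ ∑ xs (λ x → ∑ (h x) f)
∑-concatMap []       h f = refl
∑-concatMap (x ∷ xs) h f = trans (∑-++ (h x) (concatMap h xs) f) (cong (∑ (h x) f +_) (∑-concatMap xs h f))

∑-comm : (xs : List A) (ys : List B) (f : A → B → ℕ) →
         ∑ xs (λ x → ∑ ys (f x)) ≡ ∑ ys (λ y → ∑ xs (λ x → f x y))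
∑-comm []       ys f = sym (∑-zero ys)
∑-comm (x ∷ xs) ys f = trans (cong (∑ ys (f x) +_) (∑-comm xs ys f)) (sym (∑-+ ys (f x) (λ y → ∑ xs (λ x → f x y))))


length-allFin : ∀ k → length (allFin k) ≡ k
length-allFin k = length-tabulate (λ j → j)

∑-allFin-suc : ∀ {k} (f : Fin (suc k) → ℕ) → ∑ (allFin (suc k)) f ≡ f Fin.zero + ∑ (allFin k) (f ∘ Fin.suc)
∑-allFin-suc {k} f = cong (f Fin.zero +_) (begin
    ∑ (tabulate Fin.suc) f
  ≡⟨ cong (λ xs → ∑ xs f) (map-tabulate (λ j → j) Fin.suc) ⟨
    ∑ (map Fin.suc (allFin k)) f
  ≡⟨ ∑-map (allFin k) Fin.suc f ⟩
    ∑ (allFin k) (f ∘ Fin.suc)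
  ∎)
  where open ≡-Reasoning

∑-allFin-≟ : ∀ {k} (i : Fin k) (b : ℕ) → ∑ (allFin k) (λ j → if does (j ≟ i) then b else 0) ≡ b
∑-allFin-≟ {suc k} Fin.zero    b = begin
    ∑ (allFin (suc k)) (λ j → if does (j ≟ Fin.zero) then b else 0)
  ≡⟨ ∑-allFin-suc {k} (λ j → if does (j ≟ Fin.zero) then b else 0) ⟩
    b + ∑ (allFin k) (λ _ → 0)
  ≡⟨ cong (b +_) (∑-zero (allFin k)) ⟩
    b + 0
  ≡⟨ +-identityʳ b ⟩
    b
  ∎
  where open ≡-Reasoning
∑-allFin-≟ {suc k} (Fin.suc i) b =
  trans (∑-allFin-suc {k} (λ j → if does (j ≟ Fin.suc i) then b else 0)) (∑-allFin-≟ i b)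

f[max]≤∑f : (f : ℕ → ℕ) → f 0 ≡ 0 → (xs : List A) (g : A → ℕ) → f (foldr _⊔_ 0 (map g xs)) ≤ ∑ xs (f ∘ g)
f[max]≤∑f f f0≡0 []       g = ≤-reflexive f0≡0
f[max]≤∑f f f0≡0 (x ∷ xs) g with ⊔-sel (g x) (foldr _⊔_ 0 (map g xs))
... | inj₁ max≡gx rewrite max≡gx = m≤m+n (f (g x)) _
... | inj₂ max≡rest rewrite max≡rest = ≤-trans (f[max]≤∑f f f0≡0 xs g) (m≤n+m _ (f (g x)))

length-filter*≤∑ : {P : A → Set} (P? : Decidable P) (xs : List A) (c : ℕ) (g : A → ℕ) →
                   (∀ x → P x → c ≤ g x) → length (filter P? xs) * c ≤ ∑ xs g
length-filter*≤∑ P? []       c g P⇒c≤g = z≤n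
length-filter*≤∑ P? (x ∷ xs) c g P⇒c≤g with P? x
... | yes Px = +-mono-≤ (P⇒c≤g x Px) (length-filter*≤∑ P? xs c g P⇒c≤g)
... | no  _  = ≤-trans (length-filter*≤∑ P? xs c g P⇒c≤g) (m≤n+m _ (g x))

module _ {k : ℕ} (i : Fin k) where

  ∑-allOutcomes-∷ : ∀ n (f g : ℕ → ℕ) → (∀ L → f (suc L) ≡ f L + g L) →
                    ∑ (allOutcomes k (suc n)) (λ v → f (load v i))
                    ≡ k * ∑ (allOutcomes k n) (λ v → f (load v i)) + ∑ (allOutcomes k n) (λ v → g (load v i))
  ∑-allOutcomes-∷ n f g f-suc = begin
      ∑ (allOutcomes k (suc n)) (λ v → f (load v i))
    ≡⟨ ∑-concatMap (allFin k) (λ j → map (j ∷_) Ω) _ ⟩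
      ∑ (allFin k) (λ j → ∑ (map (j ∷_) Ω) (λ v → f (load v i)))
    ≡⟨ ∑-cong (allFin k) (λ j → trans (∑-map Ω (j ∷_) _) (first-robot j)) ⟩
      ∑ (allFin k) (λ j → Φ + (if does (j ≟ i) then Ψ else 0))
    ≡⟨ ∑-+ (allFin k) (λ _ → Φ) _ ⟩
      ∑ (allFin k) (λ _ → Φ) + ∑ (allFin k) (λ j → if does (j ≟ i) then Ψ else 0)
    ≡⟨ cong₂ _+_ (trans (∑-const (allFin k) Φ) (cong (_* Φ) (length-allFin k))) (∑-allFin-≟ i Ψ) ⟩
      k * Φ + Ψ
    ∎
    where
    open ≡-Reasoning
    Ω : List (Vec (Fin k) n)
    Ω = allOutcomes k n
    Φ Ψ : ℕ
    Φ = ∑ Ω (λ v → f (load v i))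
    Ψ = ∑ Ω (λ v → g (load v i))
    first-robot : ∀ j → ∑ Ω (λ w → f (load (j ∷ w) i)) ≡ Φ + (if does (j ≟ i) then Ψ else 0)
    first-robot j with does (j ≟ i)
    ... | true  = trans (∑-cong Ω (λ w → f-suc (load w i))) (∑-+ Ω _ _)
    ... | false = sym (+-identityʳ Φ)

  -- k^n times the r-th factorial moment E[(X_i)_r] for n robots.
  factorialMoment : ℕ → ℕ → ℕ
  factorialMoment n r = ∑ (allOutcomes k n) (λ v → load v i P′ r)

  factorialMoment-suc-zero : ∀ n → factorialMoment (suc n) 0 ≡ k * factorialMoment n 0
  factorialMoment-suc-zero n = begin
      factorialMoment (suc n) 0
    ≡⟨ ∑-allOutcomes-∷ n (λ _ → 1) (λ _ → 0) (λ _ → refl) ⟩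
      k * factorialMoment n 0 + ∑ (allOutcomes k n) (λ _ → 0)
    ≡⟨ cong (k * factorialMoment n 0 +_) (∑-zero (allOutcomes k n)) ⟩
      k * factorialMoment n 0 + 0
    ≡⟨ +-identityʳ (k * factorialMoment n 0) ⟩
      k * factorialMoment n 0
    ∎
    where open ≡-Reasoning

  factorialMoment-suc-suc : ∀ n r → factorialMoment (suc n) (suc r) ≡ k * factorialMoment n (suc r) + suc r * factorialMoment n r
  factorialMoment-suc-suc n r =
    trans (∑-allOutcomes-∷ n (_P′ suc r) (λ L → suc r * (L P′ r)) (λ L → P′-pascal L r))
          (cong (k * factorialMoment n (suc r) +_) (∑-*ˡ (allOutcomes k n) (suc r) (λ v → load v i P′ r)))

  factorialMoment*k^r : ∀ n r → factorialMoment n r * k ^ r ≡ (n P′ r) * k ^ n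
  factorialMoment*k^r zero    zero    = refl
  factorialMoment*k^r zero    (suc r) rewrite P′-vanish {0} {suc r} (s≤s z≤n) = refl
  factorialMoment*k^r (suc n) zero    = begin
      factorialMoment (suc n) 0 * 1
    ≡⟨ cong (_* 1) (factorialMoment-suc-zero n) ⟩
      k * factorialMoment n 0 * 1
    ≡⟨ *-assoc k (factorialMoment n 0) 1 ⟩
      k * (factorialMoment n 0 * 1)
    ≡⟨ cong (k *_) (factorialMoment*k^r n 0) ⟩
      k * (1 * k ^ n)
    ≡⟨ x∙yz≈y∙xz k 1 (k ^ n) ⟩
      1 * (k * k ^ n)
    ∎
    where open ≡-Reasoning
  factorialMoment*k^r (suc n) (suc r) = begin
      factorialMoment (suc n) (suc r) * (k * k ^ r)
    ≡⟨ cong (_* (k * k ^ r)) (factorialMoment-suc-suc n r) ⟩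
      (k * factorialMoment n (suc r) + suc r * factorialMoment n r) * (k * k ^ r)
    ≡⟨ regroup k (suc r) (factorialMoment n (suc r)) (factorialMoment n r) (k ^ r) ⟩
      k * (factorialMoment n (suc r) * (k * k ^ r)) + suc r * k * (factorialMoment n r * k ^ r)
    ≡⟨ cong₂ (λ a b → k * a + suc r * k * b) (factorialMoment*k^r n (suc r)) (factorialMoment*k^r n r) ⟩
      k * ((n P′ suc r) * k ^ n) + suc r * k * ((n P′ r) * k ^ n)
    ≡⟨ collect k (suc r) (n P′ suc r) (n P′ r) (k ^ n) ⟩
      (n P′ suc r + suc r * (n P′ r)) * (k * k ^ n)
    ≡⟨ cong (_* (k * k ^ n)) (P′-pascal n r) ⟨
      (suc n P′ suc r) * (k * k ^ n)
    ∎
    where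
    open ≡-Reasoning
    regroup : ∀ k a x y p → (k * x + a * y) * (k * p) ≡ k * (x * (k * p)) + a * k * (y * p)
    regroup = solve-∀
    collect : ∀ k a x y q → k * (x * q) + a * k * (y * q) ≡ (x + a * y) * (k * q)
    collect = solve-∀

∑-factorialMoments : ∀ k n r → ∑ (allOutcomes k n) (λ v → ∑ (allFin k) (λ i → load v i P′ r)) * k ^ r ≡ k * ((n P′ r) * k ^ n)
∑-factorialMoments k n r = begin
    ∑ (allOutcomes k n) (λ v → ∑ (allFin k) (λ i → load v i P′ r)) * k ^ r
  ≡⟨ cong (_* k ^ r) (∑-comm (allOutcomes k n) (allFin k) (λ v i → load v i P′ r)) ⟩
    ∑ (allFin k) (λ i → factorialMoment i n r) * k ^ r
  ≡⟨ ∑-*ʳ (allFin k) (λ i → factorialMoment i n r) (k ^ r) ⟨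
    ∑ (allFin k) (λ i → factorialMoment i n r * k ^ r)
  ≡⟨ ∑-cong (allFin k) (λ i → factorialMoment*k^r i n r) ⟩
    ∑ (allFin k) (λ _ → (n P′ r) * k ^ n)
  ≡⟨ ∑-const (allFin k) _ ⟩
    length (allFin k) * ((n P′ r) * k ^ n)
  ≡⟨ cong (_* ((n P′ r) * k ^ n)) (length-allFin k) ⟩
    k * ((n P′ r) * k ^ n)
  ∎
  where open ≡-Reasoning

badCount-markov : ∀ K n k r c →
                  ((v : Vec (Fin k) n) → Exceeds K n k (maxLoad v) → c ≤ ∑ (allFin k) (λ i → load v i P′ r) * k ^ r) →
                  badCount K n k * c ≤ k * ((n P′ r) * k ^ n)
badCount-markov K n k r c bad⇒c≤ = begin
    badCount K n k * c
  ≤⟨ length-filter*≤∑ (λ v → exceeds? K n k (maxLoad v)) Ω c (λ v → T v * k ^ r) bad⇒c≤ ⟩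
    ∑ Ω (λ v → T v * k ^ r)
  ≡⟨ ∑-*ʳ Ω T (k ^ r) ⟩
    ∑ Ω T * k ^ r
  ≡⟨ ∑-factorialMoments k n r ⟩
    k * ((n P′ r) * k ^ n)
  ∎
  where
  open ≤-Reasoning
  Ω : List (Vec (Fin k) n)
  Ω = allOutcomes k n
  T : Vec (Fin k) n → ℕ
  T v = ∑ (allFin k) (λ i → load v i P′ r)

k≤[1+A]*k^K : ∀ A K {n k} → k ≤ A * n ^ K → k ≤ suc A * k ^ K
k≤[1+A]*k^K A zero    k≤A = ≤-trans k≤A (*-monoˡ-≤ 1 (n≤1+n A))
k≤[1+A]*k^K A (suc K) {k = k} _ = ≤-trans (m≤m^[1+n] k K) (m≤n*m (k ^ suc K) (suc A))

module Thresholds (A K : ℕ) where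

  c s r N : ℕ
  c = 2 ^ suc K
  s = 2 * c * suc A
  r = suc K * s
  N = suc A * (2 * r) ^ suc K

  instance
    c≢0 : NonZero c
    c≢0 = m^n≢0 2 (suc K)
    s≢0 : NonZero s
    s≢0 = m*n≢0 (2 * c) (suc A) {{m*n≢0 2 c}}
    r≢0 : NonZero r
    r≢0 = m*n≢0 (suc K) s

  r≤N : r ≤ N
  r≤N = begin
      r
    ≤⟨ m≤m+n r (r + 0) ⟩
      2 * r
    ≤⟨ m≤m^[1+n] (2 * r) K ⟩
      (2 * r) ^ suc K
    ≤⟨ m≤n*m _ (suc A) ⟩
      N
    ∎
    where open ≤-Reasoning

  module _ {n k : ℕ} (N≤n : N ≤ n) (k≤An^K : k ≤ A * n ^ K) where

    [2kr]^[1+K]≤n^[1+K]*k^K : (2 * (k * r)) ^ suc K ≤ n ^ suc K * k ^ K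
    [2kr]^[1+K]≤n^[1+K]*k^K = begin
        (2 * (k * r)) ^ suc K
      ≡⟨ cong (_^ suc K) (x∙yz≈y∙xz 2 k r) ⟩
        (k * R) ^ suc K
      ≡⟨ ^-distribʳ-* k R (suc K) ⟩
        k * k ^ K * R ^ suc K
      ≡⟨ regroup k (k ^ K) (R ^ suc K) ⟩
        k ^ K * (k * R ^ suc K)
      ≤⟨ *-monoʳ-≤ (k ^ K) (*-monoˡ-≤ (R ^ suc K) k≤An^K) ⟩
        k ^ K * (A * n ^ K * R ^ suc K)
      ≡⟨ regroup′ (k ^ K) A (n ^ K) (R ^ suc K) ⟩
        k ^ K * n ^ K * (A * R ^ suc K)
      ≤⟨ *-monoʳ-≤ (k ^ K * n ^ K) (≤-trans (m≤n+m _ (R ^ suc K)) N≤n) ⟩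
        k ^ K * n ^ K * n
      ≡⟨ regroup″ (k ^ K) (n ^ K) n ⟩
        n * n ^ K * k ^ K
      ∎
      where
      open ≤-Reasoning
      R : ℕ
      R = 2 * r
      regroup : ∀ k p q → k * p * q ≡ p * (k * q)
      regroup = solve-∀
      regroup′ : ∀ p a m q → p * (a * m * q) ≡ p * m * (a * q)
      regroup′ = solve-∀
      regroup″ : ∀ p m n → p * m * n ≡ n * m * p
      regroup″ = solve-∀

    exceeds⇒2kr≤excess : ∀ {M} → Exceeds K n k M → 2 * (k * r) ≤ k * M ∸ n
    exceeds⇒2kr≤excess {M} (_ , y*d<D^) = <⇒≤ (≰⇒> λ D≤2kr → <-irrefl refl (begin-strict
        (k * M ∸ n) ^ suc K
      ≤⟨ ^-monoˡ-≤ (suc K) D≤2kr ⟩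
        (2 * (k * r)) ^ suc K
      ≤⟨ [2kr]^[1+K]≤n^[1+K]*k^K ⟩
        n ^ suc K * k ^ K
      <⟨ y*d<D^ ⟩
        (k * M ∸ n) ^ suc K
      ∎))
      where open ≤-Reasoning

    c*2k≤c+s*k^K : c * (2 * k) ≤ c + s * k ^ K
    c*2k≤c+s*k^K = begin
        c * (2 * k)
      ≤⟨ *-monoʳ-≤ c (*-monoʳ-≤ 2 (k≤[1+A]*k^K A K k≤An^K)) ⟩
        c * (2 * (suc A * k ^ K))
      ≡⟨ regroup c (suc A) (k ^ K) ⟩
        s * k ^ K
      ≤⟨ m≤n+m (s * k ^ K) c ⟩
        c + s * k ^ K
      ∎
      where
      open ≤-Reasoning
      regroup : ∀ c a d → c * (2 * (a * d)) ≡ 2 * c * a * d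
      regroup = solve-∀

    exceeds⇒P′-bound : ∀ {M} → Exceeds K n k M → 2 * k * (n P′ r) ≤ (M P′ r) * k ^ r
    exceeds⇒P′-bound {M} ex@(n<kM , y*d<D^) = begin
        2 * k * (n P′ r)
      ≤⟨ *-monoʳ-≤ (2 * k) (P′≤^ n r) ⟩
        2 * k * n ^ r
      ≡⟨ cong (2 * k *_) (^-*-assoc n (suc K) s) ⟨
        2 * k * (n ^ suc K) ^ s
      ≤⟨ bernoulli-ratio s ratio c*2k≤c+s*k^K ⟩
        ((k * M ∸ k * r) ^ suc K) ^ s
      ≡⟨ ^-*-assoc (k * M ∸ k * r) (suc K) s ⟩
        (k * M ∸ k * r) ^ r
      ≡⟨ cong (_^ r) (*-distribˡ-∸ k M r) ⟨
        (k * (M ∸ r)) ^ r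
      ≡⟨ ^-distribʳ-* k (M ∸ r) r ⟩
        k ^ r * (M ∸ r) ^ r
      ≤⟨ *-monoʳ-≤ (k ^ r) (∸^≤P′ M r) ⟩
        k ^ r * (M P′ r)
      ≡⟨ *-comm (k ^ r) (M P′ r) ⟩
        (M P′ r) * k ^ r
      ∎
      where
      open ≤-Reasoning
      ratio : (c + k ^ K) * n ^ suc K ≤ c * (k * M ∸ k * r) ^ suc K
      ratio = excess⇒ratio K {a = k * r} (<⇒≤ n<kM) (exceeds⇒2kr≤excess ex) (<⇒≤ y*d<D^)

    exceeds⇒∑P′-bound : (v : Vec (Fin k) n) → Exceeds K n k (maxLoad v) →
                        2 * k * (n P′ r) ≤ ∑ (allFin k) (λ i → load v i P′ r) * k ^ r
    exceeds⇒∑P′-bound v ex = ≤-trans (exceeds⇒P′-bound ex) (*-monoˡ-≤ (k ^ r) max≤∑)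
      where
      max≤∑ : maxLoad v P′ r ≤ ∑ (allFin k) (λ i → load v i P′ r)
      max≤∑ = f[max]≤∑f (_P′ r) (P′-vanish (>-nonZero⁻¹ r)) (allFin k) (load v)

lemma3 : (A K : ℕ) → ∃[ N ] ((n k : ℕ) → N ≤ n → 1 ≤ k → k ≤ A * n ^ K → 2 * badCount K n k ≤ k ^ n)
lemma3 A K = N , bound
  where
  open Thresholds A K
  bound : (n k : ℕ) → N ≤ n → 1 ≤ k → k ≤ A * n ^ K → 2 * badCount K n k ≤ k ^ n
  bound n k N≤n 1≤k k≤An^K = *-cancelʳ-≤ (2 * badCount K n k) (k ^ n) (k * (n P′ r)) (begin
      2 * badCount K n k * (k * (n P′ r))
    ≡⟨ regroup (badCount K n k) k (n P′ r) ⟩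
      badCount K n k * (2 * k * (n P′ r))
    ≤⟨ badCount-markov K n k r _ (exceeds⇒∑P′-bound N≤n k≤An^K) ⟩
      k * ((n P′ r) * k ^ n)
    ≡⟨ regroup′ k (n P′ r) (k ^ n) ⟩
      k ^ n * (k * (n P′ r))
    ∎)
    where
    open ≤-Reasoning
    instance
      k*nP′r≢0 : NonZero (k * (n P′ r))
      k*nP′r≢0 = m*n≢0 k (n P′ r) {{>-nonZero 1≤k}} {{>-nonZero (P′>0 (≤-trans r≤N N≤n))}}
    regroup : ∀ b k p → 2 * b * (k * p) ≡ b * (2 * k * p)
    regroup = solve-∀
    regroup′ : ∀ k p q → k * (p * q) ≡ q * (k * p)
    regroup′ = solve-∀
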